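{- Let $n\ge 3$, let $P_n=u_1u_2\ldots u_n$ be a simple path, let $\overleftrightarrow{P}_n$ be its complete biorientation, and let $P_n^*$ be the digraph obtained from $\overleftrightarrow{P}_n$ by adding exactly one of the arcs $(u_1,u_n)$ or $(u_n,u_1)$. Then $\xi^C(P_n)=\xi^C(\overleftrightarrow{P}_n)\le \xi^C(P_n^*)$.
   Context: The complete biorientation of an undirected graph replaces each edge $\{x,y\}$ by both arcs $(x,y)$ and $(y,x)$. For a graph $G$, $\xi^C(G)=\sum_u d_u\,\mathrm{ecc}(u)$ with $d_u$ the degree and $\mathrm{ecc}(u)$ the eccentricity. For a strongly connected digraph $D=(V,A)$ (no loops, no parallel arcs), $\vec d(u,v)$ is the length of a shortest directed $u$–$v$ path, $md(u,v)=\max\{\vec d(u,v),\vec d(v,u)\}$, $mecc(u)=\max\{md(u,v):v\in V\}$, and $\xi^C(D)=\frac12\sum_{u\in V}(d^+_u+d^-_u)\,mecc(u)$, where $d^+_u,d^-_u$ are the out-degree and in-degree. -}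

module Defs where

open import Data.Bool using (Bool; true; false; _∧_; _∨_; if_then_else_; T)
open import Data.Nat using (ℕ; zero; suc; _+_; _*_; _⊔_; _≤_)
open import Data.Fin using (Fin; toℕ; fromℕ; fromℕ<; opposite) renaming (zero to fz; suc to fs)
open import Data.Fin.Properties using () renaming (_≟_ to _≟ᶠ_)
open import Data.Integer using (+_)
open import Data.Rational using (ℚ; _/_)
open import Relation.Nullary.Decidable using (⌊_⌋)
open import Relation.Binary.PropositionalEquality using (_≡_)
open import Data.Empty using (⊥)

sumF : ∀ {n} → (Fin n → ℕ) → ℕ
sumF {zero}  f = 0
sumF {suc n} f = f fz + sumF (λ i → f (fs i))

maxF : ∀ {n} → (Fin n → ℕ) → ℕ
maxF {zero}  f = 0
maxF {suc n} f = f fz ⊔ maxF (λ i → f (fs i))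

anyF : ∀ {n} → (Fin n → Bool) → Bool
anyF {zero}  f = false
anyF {suc n} f = f fz ∨ anyF (λ i → f (fs i))

countF : ∀ {n} → (Fin n → Bool) → ℕ
countF f = sumF (λ i → if f i then 1 else 0)

reach : ∀ {n} → (Fin n → Fin n → Bool) → ℕ → Fin n → Fin n → Bool
reach adj zero    u v = ⌊ u ≟ᶠ v ⌋
reach adj (suc k) u v = reach adj k u v ∨ anyF (λ w → reach adj k u w ∧ adj w v)

leastFrom : ℕ → ℕ → (ℕ → Bool) → ℕ
leastFrom zero     start p = start
leastFrom (suc fu) start p = if p start then start else leastFrom fu (suc start) p

-- length of a shortest directed walk (= shortest directed path) from u to v;
-- shortest paths have length < n, so value n means "unreachable"
-- (never occurs for the strongly connected digraphs considered here).
dist : ∀ {n} → (Fin n → Fin n → Bool) → Fin n → Fin n → ℕ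
dist {n} adj u v = leastFrom n 0 (λ k → reach adj k u v)

record Graph (n : ℕ) : Set where
  field
    adj    : Fin n → Fin n → Bool
    sym    : ∀ x y → adj x y ≡ adj y x
    irrefl : ∀ x → adj x x ≡ false

-- digraph without loops; parallel arcs impossible since arcs form a relation
record Digraph (n : ℕ) : Set where
  field
    arc    : Fin n → Fin n → Bool
    irrefl : ∀ x → arc x x ≡ false

open Graph
open Digraph

StronglyConnected : ∀ {n} → Digraph n → Set
StronglyConnected {n} D = ∀ u v → T (reach (arc D) n u v)

degree : ∀ {n} → Graph n → Fin n → ℕ
degree G u = countF (λ v → adj G u v)

ecc : ∀ {n} → Graph n → Fin n → ℕ
ecc G u = maxF (λ v → dist (adj G) u v)

ξG : ∀ {n} → Graph n → ℕ
ξG G = sumF (λ u → degree G u * ecc G u)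

outdeg indeg : ∀ {n} → Digraph n → Fin n → ℕ
outdeg D u = countF (λ v → arc D u v)
indeg  D u = countF (λ v → arc D v u)

md : ∀ {n} → Digraph n → Fin n → Fin n → ℕ
md D u v = dist (arc D) u v ⊔ dist (arc D) v u

mecc : ∀ {n} → Digraph n → Fin n → ℕ
mecc D u = maxF (λ v → md D u v)

ξD : ∀ {n} → Digraph n → ℚ
ξD D = (+ sumF (λ u → (outdeg D u + indeg D u) * mecc D u)) / 2

ξGℚ : ∀ {n} → Graph n → ℚ
ξGℚ G = (+ ξG G) / 1

biorient : ∀ {n} → Graph n → Digraph n
biorient G = record { arc = adj G ; irrefl = irrefl G }

-- The path P_n = u_1 … u_n on Fin n (u_i is vertex i-1): i ~ j iff |i - j| = 1

pathAdj : ∀ {n} → Fin n → Fin n → Bool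
pathAdj i j = ⌊ Data.Nat._≟_ (suc (toℕ i)) (toℕ j) ⌋ ∨ ⌊ Data.Nat._≟_ (suc (toℕ j)) (toℕ i) ⌋

open import Data.Bool.Properties using (∨-comm)
open import Relation.Nullary using (¬_; no; yes)
open import Data.Nat.Properties using (n<1+n; <-irrefl)
import Data.Nat as N
open import Relation.Binary.PropositionalEquality using (_≢_; refl) renaming (sym to ≡sym)

private
  noSuc : ∀ m → ⌊ N._≟_ (suc m) m ⌋ ≡ false
  noSuc m with N._≟_ (suc m) m
  ... | yes e = Data.Empty.⊥-elim (<-irrefl (≡sym e) (n<1+n m))
  ... | no _  = refl

pathAdj-irrefl : ∀ {n} (i : Fin n) → pathAdj i i ≡ false
pathAdj-irrefl i rewrite noSuc (toℕ i) = refl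

pathAdj-sym : ∀ {n} (i j : Fin n) → pathAdj i j ≡ pathAdj j i
pathAdj-sym i j = ∨-comm (⌊ N._≟_ (suc (toℕ i)) (toℕ j) ⌋) (⌊ N._≟_ (suc (toℕ j)) (toℕ i) ⌋)

P : (n : ℕ) → Graph n
P n = record { adj = pathAdj ; sym = pathAdj-sym ; irrefl = pathAdj-irrefl }

addArc : ∀ {n} → Digraph n → (x y : Fin n) → x ≢ y → Digraph n
addArc {n} D x y x≢y = record
  { arc    = λ i j → arc D i j ∨ (⌊ i ≟ᶠ x ⌋ ∧ ⌊ j ≟ᶠ y ⌋)
  ; irrefl = λ i → lemma i }
  where
  lemma : ∀ i → (arc D i i ∨ (⌊ i ≟ᶠ x ⌋ ∧ ⌊ i ≟ᶠ y ⌋)) ≡ false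
  lemma i rewrite Digraph.irrefl D i with i ≟ᶠ x | i ≟ᶠ y
  ... | yes refl | yes refl = Data.Empty.⊥-elim (x≢y refl)
  ... | yes _ | no _ = refl
  ... | no _ | _ = refl

u₁ : ∀ {n} → 3 N.≤ n → Fin n
u₁ {suc n} _ = fz

uₙ : ∀ {n} → 3 N.≤ n → Fin n
uₙ {suc n} _ = fromℕ n

u₁≢uₙ : ∀ {n} (h : 3 N.≤ n) → u₁ h ≢ uₙ h
u₁≢uₙ {suc (suc n)} _ ()
u₁≢uₙ {suc zero} (N.s≤s ())

Pstar : (n : ℕ) → 3 N.≤ n → Bool → Digraph n
Pstar n h true  = addArc (biorient (P n)) (u₁ h) (uₙ h) (u₁≢uₙ h)
Pstar n h false = addArc (biorient (P n)) (uₙ h) (u₁ h) (λ e → u₁≢uₙ h (≡sym e))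

-- Index the vertices of P_n by 0 … n-1 and call φ : Fin n → Fin n a 1-Lipschitz potential
-- for a digraph if φ drops by at most one along every arc; then φ u ∸ φ v bounds the
-- directed distance from u to v.  For the biorientation of P_n both the index and the
-- reversed index are such potentials, so md(u,v) = |u − v| and mecc = ecc; as in- and
-- out-degrees equal the degree, ξ^C(P_n) = ξ^C of the biorientation.  Adding the arc
-- (u_1,u_n) keeps the index 1-Lipschitz, since the new arc leaves index 0; adding (u_n,u_1)
-- keeps the reversed index 1-Lipschitz.  Hence in P_n^* still md(u,v) ≥ |u − v|, while
-- degrees only grow, so every summand of ξ^C grows.
module Submission where

open import Defs
open import Algebra.Properties.CommutativeSemigroup using (interchange)
open import Data.Bool using (Bool; true; false; T; if_then_else_)
open import Data.Bool.Properties using (T-∨; T-∧)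
open import Data.Empty using (⊥-elim)
open import Data.Fin using (Fin; toℕ; fromℕ; fromℕ<; opposite) renaming (zero to fz; suc to fs)
open import Data.Fin.Properties using (toℕ-injective; toℕ<n; toℕ-fromℕ; toℕ-fromℕ<; opposite-prop)
  renaming (_≟_ to _≟ᶠ_)
open import Data.Nat using (ℕ; _≟_; zero; suc; _+_; _*_; _∸_; _⊔_; ∣_-_∣; _≤_; _<_; z≤n; s≤s; z<s)
open import Data.Nat.Properties
open import Data.Product using (_×_; _,_; ∃; proj₁)
open import Data.Sum using (_⊎_; inj₁; inj₂)
open import Function using (id)
open import Function.Bundles using (Equivalence)
open import Relation.Binary.PropositionalEquality
  using (_≡_; _≢_; refl; sym; trans; cong; cong₂; subst; subst₂; module ≡-Reasoning)
open import Relation.Nullary.Decidable using (⌊_⌋; fromWitness; toWitness)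
import Data.Integer as ℤ
import Data.Integer.Properties as ℤ
import Data.Rational as ℚ
import Data.Rational.Properties as ℚ
import Data.Rational.Unnormalised as ℚᵘ
import Data.Rational.Unnormalised.Properties as ℚᵘ

open Equivalence using (to; from)
open Digraph

private
  variable
    n : ℕ

∣m-n∣≡[m∸n]⊔[n∸m] : ∀ m n → ∣ m - n ∣ ≡ (m ∸ n) ⊔ (n ∸ m)
∣m-n∣≡[m∸n]⊔[n∸m] zero    zero    = refl
∣m-n∣≡[m∸n]⊔[n∸m] zero    (suc n) = refl
∣m-n∣≡[m∸n]⊔[n∸m] (suc m) zero    = refl
∣m-n∣≡[m∸n]⊔[n∸m] (suc m) (suc n) = ∣m-n∣≡[m∸n]⊔[n∸m] m n

∣m-1+m∣≡1 : ∀ m → ∣ m - suc m ∣ ≡ 1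
∣m-1+m∣≡1 zero    = refl
∣m-1+m∣≡1 (suc m) = ∣m-1+m∣≡1 m

[m∸n]∸[m∸o]≡o∸n : ∀ m n {o} → o ≤ m → (m ∸ n) ∸ (m ∸ o) ≡ o ∸ n
[m∸n]∸[m∸o]≡o∸n m       n       z≤n           = trans (m≤n⇒m∸n≡0 (m∸n≤m m n)) (sym (0∸n≡0 n))
[m∸n]∸[m∸o]≡o∸n (suc m) zero    (s≤s {o} o≤m) =
  trans (+-∸-assoc 1 (m∸n≤m m o)) (cong suc (m∸[m∸n]≡n o≤m))
[m∸n]∸[m∸o]≡o∸n (suc m) (suc n) (s≤s o≤m)     = [m∸n]∸[m∸o]≡o∸n m n o≤m

toℕ-opposite-∸ : (i j : Fin n) → toℕ (opposite i) ∸ toℕ (opposite j) ≡ toℕ j ∸ toℕ i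
toℕ-opposite-∸ {n} i j = trans (cong₂ _∸_ (opposite-prop i) (opposite-prop j))
  ([m∸n]∸[m∸o]≡o∸n n (suc (toℕ i)) (toℕ<n j))

IndexIsometry : (Fin n → Fin n) → Set
IndexIsometry φ = ∀ i j → ∣ toℕ (φ i) - toℕ (φ j) ∣ ≡ ∣ toℕ i - toℕ j ∣

id-isometry : IndexIsometry (id {A = Fin n})
id-isometry i j = refl

opposite-isometry : IndexIsometry (opposite {n})
opposite-isometry i j = begin
  ∣ i′ - j′ ∣                        ≡⟨ ∣m-n∣≡[m∸n]⊔[n∸m] i′ j′ ⟩
  (i′ ∸ j′) ⊔ (j′ ∸ i′)              ≡⟨ cong₂ _⊔_ (toℕ-opposite-∸ i j) (toℕ-opposite-∸ j i) ⟩
  (toℕ j ∸ toℕ i) ⊔ (toℕ i ∸ toℕ j)  ≡⟨ ⊔-comm (toℕ j ∸ toℕ i) (toℕ i ∸ toℕ j) ⟩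
  (toℕ i ∸ toℕ j) ⊔ (toℕ j ∸ toℕ i)  ≡⟨ ∣m-n∣≡[m∸n]⊔[n∸m] (toℕ i) (toℕ j) ⟨
  ∣ toℕ i - toℕ j ∣                  ∎
  where
  open ≡-Reasoning
  i′ j′ : ℕ
  i′ = toℕ (opposite i)
  j′ = toℕ (opposite j)

anyF-witness : (f : Fin n → Bool) → T (anyF f) → ∃ λ i → T (f i)
anyF-witness {suc n} f t with to (T-∨ {f fz}) t
... | inj₁ t₀ = fz , t₀
... | inj₂ t₊ with anyF-witness (λ i → f (fs i)) t₊
...   | i , tᵢ = fs i , tᵢ

anyF-intro : (f : Fin n → Bool) (i : Fin n) → T (f i) → T (anyF f)
anyF-intro f fz     t = from (T-∨ {f fz}) (inj₁ t)
anyF-intro f (fs i) t = from (T-∨ {f fz}) (inj₂ (anyF-intro (λ j → f (fs j)) i t))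

sumF-cong : (f g : Fin n → ℕ) → (∀ i → f i ≡ g i) → sumF f ≡ sumF g
sumF-cong {zero}  f g f≡g = refl
sumF-cong {suc n} f g f≡g = cong₂ _+_ (f≡g fz) (sumF-cong _ _ (λ i → f≡g (fs i)))

sumF-mono : (f g : Fin n → ℕ) → (∀ i → f i ≤ g i) → sumF f ≤ sumF g
sumF-mono {zero}  f g f≤g = z≤n
sumF-mono {suc n} f g f≤g = +-mono-≤ (f≤g fz) (sumF-mono _ _ (λ i → f≤g (fs i)))

sumF-+ : (f g : Fin n → ℕ) → sumF (λ i → f i + g i) ≡ sumF f + sumF g
sumF-+ {zero}  f g = refl
sumF-+ {suc n} f g = trans (cong (f fz + g fz +_) (sumF-+ (λ i → f (fs i)) (λ i → g (fs i))))
  (interchange +-commutativeSemigroup (f fz) (g fz) _ _)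

maxF-cong : (f g : Fin n → ℕ) → (∀ i → f i ≡ g i) → maxF f ≡ maxF g
maxF-cong {zero}  f g f≡g = refl
maxF-cong {suc n} f g f≡g = cong₂ _⊔_ (f≡g fz) (maxF-cong _ _ (λ i → f≡g (fs i)))

maxF-mono : (f g : Fin n → ℕ) → (∀ i → f i ≤ g i) → maxF f ≤ maxF g
maxF-mono {zero}  f g f≤g = z≤n
maxF-mono {suc n} f g f≤g = ⊔-mono-≤ (f≤g fz) (maxF-mono _ _ (λ i → f≤g (fs i)))

countF-mono : (f g : Fin n → Bool) → (∀ i → T (f i) → T (g i)) → countF f ≤ countF g
countF-mono f g f⇒g = sumF-mono _ _ indicator-mono
  where
  indicator-mono : ∀ i → (if f i then 1 else 0) ≤ (if g i then 1 else 0)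
  indicator-mono i with f i | g i | f⇒g i
  ... | false | _     | _  = z≤n
  ... | true  | true  | _  = ≤-refl
  ... | true  | false | ff = ⊥-elim (ff _)

≤-leastFrom : ∀ (p : ℕ → Bool) {m} fuel start →
  (∀ k → T (p k) → m ≤ k) → m ≤ start + fuel → m ≤ leastFrom fuel start p
≤-leastFrom p {m} zero       start below m≤ = subst (m ≤_) (+-identityʳ start) m≤
≤-leastFrom p {m} (suc fuel) start below m≤ with p start in eq
... | true  = below start (subst T (sym eq) _)
... | false = ≤-leastFrom p fuel (suc start) below (subst (m ≤_) (+-suc start fuel) m≤)

leastFrom-≤ : ∀ (p : ℕ → Bool) fuel {start k} → start ≤ k → T (p k) → leastFrom fuel start p ≤ k
leastFrom-≤ p zero       start≤k pk = start≤k
leastFrom-≤ p (suc fuel) {start} start≤k pk with p start in eq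
... | true  = start≤k
... | false with m≤n⇒m<n∨m≡n start≤k
...   | inj₁ start<k = leastFrom-≤ p fuel start<k pk
...   | inj₂ refl    = ⊥-elim (subst T eq pk)

module _ (adj : Fin n → Fin n → Bool) where

  dist-≤ : ∀ {k} (u v : Fin n) → T (reach adj k u v) → dist adj u v ≤ k
  dist-≤ u v = leastFrom-≤ _ n z≤n

  -- `dist` returns n when no walk is found, so only bounds m ≤ n can be read off this way.
  ≤-dist : ∀ {m} (u v : Fin n) → m ≤ n → (∀ k → T (reach adj k u v) → m ≤ k) → m ≤ dist adj u v
  ≤-dist u v m≤n below = ≤-leastFrom _ n 0 below m≤n

  reach-zero : (u : Fin n) → T (reach adj 0 u u)
  reach-zero u = fromWitness refl

  reach-snoc : ∀ k {u w v : Fin n} → T (reach adj k u w) → T (adj w v) → T (reach adj (suc k) u v)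
  reach-snoc k {u} {w} {v} r a =
    from (T-∨ {reach adj k u v}) (inj₂ (anyF-intro _ w (from (T-∧ {reach adj k u w}) (r , a))))

  reach-suc : ∀ k {u v : Fin n} → T (reach adj (suc k) u v) →
    T (reach adj k u v) ⊎ ∃ λ w → T (reach adj k u w) × T (adj w v)
  reach-suc k {u} {v} r with to (T-∨ {reach adj k u v}) r
  ... | inj₁ r′ = inj₁ r′
  ... | inj₂ a with anyF-witness _ a
  ...   | w , rw = inj₂ (w , to (T-∧ {reach adj k u w}) rw)

OneLipschitz : (Fin n → Fin n → Bool) → (Fin n → Fin n) → Set
OneLipschitz adj φ = ∀ w v → T (adj w v) → toℕ (φ w) ≤ suc (toℕ (φ v))

module _ {adj : Fin n → Fin n → Bool} {φ : Fin n → Fin n} (lip : OneLipschitz adj φ) where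

  reach⇒lipschitz-drop : ∀ k {u v} → T (reach adj k u v) → toℕ (φ u) ≤ toℕ (φ v) + k
  reach⇒lipschitz-drop zero {u} {v} r with toWitness {a? = u ≟ᶠ v} r
  ... | refl = m≤m+n _ 0
  reach⇒lipschitz-drop (suc k) {u} {v} r with reach-suc adj k r
  ... | inj₁ r′ = ≤-trans (reach⇒lipschitz-drop k r′) (+-monoʳ-≤ (toℕ (φ v)) (n≤1+n k))
  ... | inj₂ (w , r′ , a) = begin
    toℕ (φ u)             ≤⟨ reach⇒lipschitz-drop k r′ ⟩
    toℕ (φ w) + k         ≤⟨ +-monoˡ-≤ k (lip w v a) ⟩
    suc (toℕ (φ v) + k)   ≡⟨ +-suc (toℕ (φ v)) k ⟨
    toℕ (φ v) + suc k     ∎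
    where open ≤-Reasoning

  lipschitz-drop≤dist : ∀ u v → toℕ (φ u) ∸ toℕ (φ v) ≤ dist adj u v
  lipschitz-drop≤dist u v = ≤-dist adj u v (≤-trans (m∸n≤m _ (toℕ (φ v))) (<⇒≤ (toℕ<n (φ u))))
    (λ k r → m≤n+o⇒m∸n≤o _ _ (reach⇒lipschitz-drop k r))

lipschitz-gap≤md : ∀ (D : Digraph n) {φ} → OneLipschitz (arc D) φ →
  ∀ u v → ∣ toℕ (φ u) - toℕ (φ v) ∣ ≤ md D u v
lipschitz-gap≤md D {φ} lip u v = subst (_≤ md D u v) (sym (∣m-n∣≡[m∸n]⊔[n∸m] (toℕ (φ u)) (toℕ (φ v))))
  (⊔-mono-≤ (lipschitz-drop≤dist lip u v) (lipschitz-drop≤dist lip v u))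

addArc-⊇ : ∀ (D : Digraph n) x y (x≢y : x ≢ y) i j → T (arc D i j) → T (arc (addArc D x y x≢y) i j)
addArc-⊇ D x y x≢y i j a = from (T-∨ {arc D i j}) (inj₁ a)

addArc-lipschitz : ∀ (D : Digraph n) x y (x≢y : x ≢ y) {φ} → OneLipschitz (arc D) φ →
  toℕ (φ x) ≡ 0 → OneLipschitz (arc (addArc D x y x≢y)) φ
addArc-lipschitz D x y x≢y {φ} lip φx≡0 w v a with to (T-∨ {arc D w v}) a
... | inj₁ a′ = lip w v a′
... | inj₂ new with toWitness {a? = w ≟ᶠ x} (proj₁ (to (T-∧ {⌊ w ≟ᶠ x ⌋}) new))
...   | refl = subst (_≤ suc (toℕ (φ v))) (sym φx≡0) z≤n

pathAdj-up : {w v : Fin n} → suc (toℕ w) ≡ toℕ v → T (pathAdj w v)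
pathAdj-up {w = w} {v} e = from (T-∨ {⌊ suc (toℕ w) ≟ toℕ v ⌋}) (inj₁ (fromWitness e))

pathAdj-down : {w v : Fin n} → suc (toℕ v) ≡ toℕ w → T (pathAdj w v)
pathAdj-down {w = w} {v} e = from (T-∨ {⌊ suc (toℕ w) ≟ toℕ v ⌋}) (inj₂ (fromWitness e))

pathAdj-gap : (w v : Fin n) → T (pathAdj w v) → ∣ toℕ w - toℕ v ∣ ≡ 1
pathAdj-gap w v a with to (T-∨ {⌊ suc (toℕ w) ≟ toℕ v ⌋}) a
... | inj₁ up   rewrite sym (toWitness up)   = ∣m-1+m∣≡1 (toℕ w)
... | inj₂ down rewrite sym (toWitness down) = trans (∣-∣-comm (suc (toℕ v)) (toℕ v)) (∣m-1+m∣≡1 (toℕ v))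

isometry⇒pathAdj-lipschitz : {φ : Fin n → Fin n} → IndexIsometry φ → OneLipschitz pathAdj φ
isometry⇒pathAdj-lipschitz {φ = φ} iso w v a =
  subst (λ d → toℕ (φ w) ≤ d + toℕ (φ v)) (trans (iso w v) (pathAdj-gap w v a)) (m≤∣m-n∣+n _ _)

reach-path-up : ∀ d (u v : Fin n) → toℕ v ≡ toℕ u + d → T (reach pathAdj d u v)
reach-path-up zero u v v≡u+0 with toℕ-injective (trans v≡u+0 (+-identityʳ (toℕ u)))
... | refl = reach-zero pathAdj v
reach-path-up {n} (suc d) u v v≡u+1+d =
  reach-snoc pathAdj d (reach-path-up d u w (toℕ-fromℕ< lt))
    (pathAdj-up (trans (cong suc (toℕ-fromℕ< lt)) (sym v≡1+u+d)))
  where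
  v≡1+u+d : toℕ v ≡ suc (toℕ u + d)
  v≡1+u+d = trans v≡u+1+d (+-suc (toℕ u) d)
  lt : toℕ u + d < n
  lt = <⇒≤ (subst (_< n) v≡1+u+d (toℕ<n v))
  w : Fin n
  w = fromℕ< lt

reach-path-down : ∀ d (u v : Fin n) → toℕ u ≡ toℕ v + d → T (reach pathAdj d u v)
reach-path-down zero u v u≡v+0 with toℕ-injective (trans u≡v+0 (+-identityʳ (toℕ v)))
... | refl = reach-zero pathAdj v
reach-path-down {n} (suc d) u v u≡v+1+d =
  reach-snoc pathAdj d (reach-path-down d u w u≡w+d) (pathAdj-down (sym (toℕ-fromℕ< lt)))
  where
  lt : suc (toℕ v) < n
  lt = ≤-trans (s≤s (subst (suc (toℕ v) ≤_) (sym u≡v+1+d) (m<m+n (toℕ v) z<s))) (toℕ<n u)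
  w : Fin n
  w = fromℕ< lt
  u≡w+d : toℕ u ≡ toℕ w + d
  u≡w+d = trans u≡v+1+d (trans (+-suc (toℕ v) d) (cong (_+ d) (sym (toℕ-fromℕ< lt))))

dist-path : (u v : Fin n) → dist pathAdj u v ≡ ∣ toℕ u - toℕ v ∣
dist-path u v = ≤-antisym upper lower
  where
  upper : dist pathAdj u v ≤ ∣ toℕ u - toℕ v ∣
  upper with ≤-total (toℕ u) (toℕ v)
  ... | inj₁ u≤v = subst (dist pathAdj u v ≤_) (sym (m≤n⇒∣m-n∣≡n∸m u≤v))
    (dist-≤ pathAdj u v (reach-path-up _ u v (sym (m+[n∸m]≡n u≤v))))
  ... | inj₂ v≤u = subst (dist pathAdj u v ≤_) (sym (m≤n⇒∣n-m∣≡n∸m v≤u))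
    (dist-≤ pathAdj u v (reach-path-down _ u v (sym (m+[n∸m]≡n v≤u))))
  lower : ∣ toℕ u - toℕ v ∣ ≤ dist pathAdj u v
  lower = subst (_≤ dist pathAdj u v) (sym (∣m-n∣≡[m∸n]⊔[n∸m] (toℕ u) (toℕ v))) (⊔-lub
    (lipschitz-drop≤dist {φ = id} (isometry⇒pathAdj-lipschitz id-isometry) u v)
    (subst (_≤ dist pathAdj u v) (toℕ-opposite-∸ u v)
      (lipschitz-drop≤dist {φ = opposite} (isometry⇒pathAdj-lipschitz opposite-isometry) u v)))

md-biorient-P : (u v : Fin n) → md (biorient (P n)) u v ≡ ∣ toℕ u - toℕ v ∣
md-biorient-P u v = trans (cong₂ _⊔_ (dist-path u v) (trans (dist-path v u) (∣-∣-comm (toℕ v) (toℕ u))))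
  (⊔-idem _)

mecc-biorient-P : (u : Fin n) → mecc (biorient (P n)) u ≡ ecc (P n) u
mecc-biorient-P u = maxF-cong _ _ (λ v → trans (md-biorient-P u v) (sym (dist-path u v)))

pos/2-mono-≤ : ∀ {a b} → a ≤ b → ℤ.+ a ℚ./ 2 ℚ.≤ ℤ.+ b ℚ./ 2
pos/2-mono-≤ {a} {b} a≤b = ℚ.toℚᵘ-cancel-≤
  (ℚᵘ.≤-respˡ-≃ (ℚᵘ.≃-sym (ℚ.toℚᵘ-fromℚᵘ (ℚᵘ.mkℚᵘ (ℤ.+ a) 1)))
  (ℚᵘ.≤-respʳ-≃ (ℚᵘ.≃-sym (ℚ.toℚᵘ-fromℚᵘ (ℚᵘ.mkℚᵘ (ℤ.+ b) 1)))
  (ℚᵘ.*≤* (subst₂ ℤ._≤_ (ℤ.pos-* a 2) (ℤ.pos-* b 2) (ℤ.+≤+ (*-monoˡ-≤ 2 a≤b))))))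

pos/1≡double/2 : ∀ a → ℤ.+ a ℚ./ 1 ≡ ℤ.+ (a + a) ℚ./ 2
pos/1≡double/2 a = ℚ.fromℚᵘ-cong {ℚᵘ.mkℚᵘ (ℤ.+ a) 0} {ℚᵘ.mkℚᵘ (ℤ.+ (a + a)) 1} (ℚᵘ.*≡* (begin
  ℤ.+ a ℤ.* ℤ.+ 2      ≡⟨ ℤ.pos-* a 2 ⟨
  ℤ.+ (a * 2)          ≡⟨ cong ℤ.+_ (trans (*-comm a 2) (cong (a +_) (+-identityʳ a))) ⟩
  ℤ.+ (a + a)          ≡⟨ ℤ.*-identityʳ (ℤ.+ (a + a)) ⟨
  ℤ.+ (a + a) ℤ.* ℤ.+ 1 ∎))
  where open ≡-Reasoning

indeg-biorient : (G : Graph n) (u : Fin n) → indeg (biorient G) u ≡ degree G u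
indeg-biorient G u = sumF-cong _ _ (λ v → cong (λ b → if b then 1 else 0) (Graph.sym G v u))

ξGℚ≡ξD-biorient : (G : Graph n) → (∀ u → mecc (biorient G) u ≡ ecc G u) → ξGℚ G ≡ ξD (biorient G)
ξGℚ≡ξD-biorient G mecc≡ecc = trans (pos/1≡double/2 (ξG G)) (cong (λ s → ℤ.+ s ℚ./ 2) (sym (begin
  sumF (λ u → (outdeg B u + indeg B u) * mecc B u)  ≡⟨ sumF-cong _ _ summand ⟩
  sumF (λ u → deg×ecc u + deg×ecc u)                ≡⟨ sumF-+ deg×ecc deg×ecc ⟩
  ξG G + ξG G                                       ∎)))
  where
  open ≡-Reasoning
  B = biorient G
  deg×ecc : Fin _ → ℕ
  deg×ecc u = degree G u * ecc G u
  summand : ∀ u → (outdeg B u + indeg B u) * mecc B u ≡ deg×ecc u + deg×ecc u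
  summand u = trans (cong₂ (λ d e → (degree G u + d) * e) (indeg-biorient G u) (mecc≡ecc u))
    (*-distribʳ-+ (ecc G u) (degree G u) (degree G u))

ξD-mono : (D D′ : Digraph n) → (∀ i j → T (arc D i j) → T (arc D′ i j)) →
  (∀ u v → md D u v ≤ md D′ u v) → ξD D ℚ.≤ ξD D′
ξD-mono D D′ D⊆D′ md≤md′ = pos/2-mono-≤ (sumF-mono _ _ (λ u →
  *-mono-≤ (+-mono-≤ (countF-mono _ _ (D⊆D′ u)) (countF-mono _ _ (λ v → D⊆D′ v u)))
           (maxF-mono _ _ (md≤md′ u))))

ξD-biorient-P-≤ : (D : Digraph n) (φ : Fin n → Fin n) → (∀ i j → T (pathAdj i j) → T (arc D i j)) →
  IndexIsometry φ → OneLipschitz (arc D) φ → ξD (biorient (P n)) ℚ.≤ ξD D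
ξD-biorient-P-≤ D φ P⊆D iso lip = ξD-mono (biorient (P _)) D P⊆D (λ u v → begin
  md (biorient (P _)) u v     ≡⟨ md-biorient-P u v ⟩
  ∣ toℕ u - toℕ v ∣           ≡⟨ iso u v ⟨
  ∣ toℕ (φ u) - toℕ (φ v) ∣   ≤⟨ lipschitz-gap≤md D lip u v ⟩
  md D u v                    ∎)
  where open ≤-Reasoning

ξD-biorient-P-≤-addArc : ∀ x y (x≢y : x ≢ y) (φ : Fin n → Fin n) → IndexIsometry φ → toℕ (φ x) ≡ 0 →
  ξD (biorient (P n)) ℚ.≤ ξD (addArc (biorient (P n)) x y x≢y)
ξD-biorient-P-≤-addArc x y x≢y φ iso φx≡0 =
  ξD-biorient-P-≤ (addArc B x y x≢y) φ (addArc-⊇ B x y x≢y) iso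
    (addArc-lipschitz B x y x≢y (isometry⇒pathAdj-lipschitz iso) φx≡0)
  where B = biorient (P _)

toℕ-u₁ : (h : 3 ≤ n) → toℕ (u₁ h) ≡ 0
toℕ-u₁ {suc n} h = refl

toℕ-opposite-uₙ : (h : 3 ≤ n) → toℕ (opposite (uₙ h)) ≡ 0
toℕ-opposite-uₙ {suc n} h = trans (opposite-prop (fromℕ n)) (trans (cong (n ∸_) (toℕ-fromℕ n)) (n∸n≡0 n))

theorem8 : (n : ℕ) (h : 3 ≤ n) (b : Bool) →
    (ξGℚ (P n) ≡ ξD (biorient (P n))) × (ξD (biorient (P n)) ℚ.≤ ξD (Pstar n h b))
theorem8 n h b = ξGℚ≡ξD-biorient (P n) mecc-biorient-P , Pstar-≥ b
  where
  Pstar-≥ : ∀ b → ξD (biorient (P n)) ℚ.≤ ξD (Pstar n h b)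
  Pstar-≥ true  = ξD-biorient-P-≤-addArc (u₁ h) (uₙ h) (u₁≢uₙ h) id id-isometry (toℕ-u₁ h)
  Pstar-≥ false = ξD-biorient-P-≤-addArc (uₙ h) (u₁ h) (λ e → u₁≢uₙ h (sym e))
    opposite opposite-isometry (toℕ-opposite-uₙ h)
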